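{- Let $b\ge 2$ be an integer. For all integers $k,m$ with $2\leq m\leq k$, $s_b(G_k(m))=H_k(m)$.
   Context: Fix an integer $b\ge 2$. A base $b$ over-expansion of a positive integer $N$ is a word $d_kd_{k-1}\cdots d_0$ over $\{0,1,\ldots,b\}$ with $d_k\neq 0$ and $\sum_{i=0}^k d_ib^i=N$. For $n\ge 2$, $s_b(n)$ is the number of base $b$ over-expansions of $n-1$; $s_b(0)=0$, $s_b(1)=1$. The integers $h_m$ are defined by $h_1=h_2=1$ and, for $m\geq 3$, $h_m=1+\sum_{i=0}^{\lfloor (m-3)/2\rfloor}b^{m-2-2i}$. For integers $2\le m\le k$, $G_k(m)=b^k+h_m$ and $H_k(m)=F_{m+2}+(k-m)F_m$, where $F_j$ are the Fibonacci numbers with $F_1=F_2=1$. -}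

module Defs where

open import Data.Nat using (ℕ; zero; suc; _+_; _*_; _∸_; _^_; _/_; _≟_)
open import Data.List using (List; []; _∷_; map; concatMap; filter; length; upTo; last)
open import Data.Maybe using (Maybe; just; nothing)
open import Relation.Nullary using (Dec; yes; no; ¬_)
open import Relation.Nullary.Decidable using (_×-dec_; ¬?)
open import Data.Product using (_×_)
open import Relation.Binary.PropositionalEquality using (_≡_)

-- A word d_k ... d_0 is represented as the list d_0 ∷ d_1 ∷ ... ∷ d_k
-- (least significant digit first).

value : ℕ → List ℕ → ℕ
value b []       = 0
value b (d ∷ ds) = d + b * value b ds

words : ℕ → ℕ → List (List ℕ)
words b zero    = [] ∷ []
words b (suc L) = concatMap (λ d → map (d ∷_) (words b L)) (upTo (suc b))

LeadingNonzero : List ℕ → Set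
LeadingNonzero ds = ¬ (last ds ≡ just 0) × ¬ (last ds ≡ nothing)

maybe≟ : (x y : Maybe ℕ) → Dec (x ≡ y)
maybe≟ = Data.Maybe.Properties.≡-dec _≟_
  where import Data.Maybe.Properties

-- ds is a base-b over-expansion of N (digits already in {0..b})
IsOverExp : ℕ → ℕ → List ℕ → Set
IsOverExp b N ds = LeadingNonzero ds × value b ds ≡ N

isOverExp? : (b N : ℕ) (ds : List ℕ) → Dec (IsOverExp b N ds)
isOverExp? b N ds =
  (¬? (maybe≟ (last ds) (just 0)) ×-dec ¬? (maybe≟ (last ds) nothing))
  ×-dec (value b ds ≟ N)

-- A nonempty word of length k+1 with
-- nonzero leading digit has value ≥ b^k ≥ k+1 (b ≥ 2), so every over-expansion
-- of N has length between 1 and N; we enumerate all words of those lengths.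
numOverExp : ℕ → ℕ → ℕ
numOverExp b N =
  length (filter (isOverExp? b N) (concatMap (λ L → words b (suc L)) (upTo N)))

s : ℕ → ℕ → ℕ
s b zero          = 0
s b (suc zero)    = 1
s b (suc (suc n)) = numOverExp b (suc n)

F : ℕ → ℕ
F zero          = 0
F (suc zero)    = 1
F (suc (suc n)) = F (suc n) + F n

sumTo : ℕ → (ℕ → ℕ) → ℕ
sumTo zero    f = 0
sumTo (suc n) f = sumTo n f + f n

h : ℕ → ℕ → ℕ
h b m with m
... | zero          = 1
... | suc zero      = 1
... | suc (suc zero) = 1
... | suc (suc (suc m')) = 1 + sumTo (suc (m' / 2)) (λ i → b ^ ((m' + 3) ∸ 2 ∸ 2 * i))

G : ℕ → ℕ → ℕ → ℕ
G b k m = b ^ k + h b m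

H : ℕ → ℕ → ℕ
H k m = F (m + 2) + (k ∸ m) * F m

-- Sorting the over-expansions of N by their lowest digit gives
--   #(r + bM) = #M  for 0 < r < b,     #(b(M + 1)) = #(M + 1) + #M  (lowest digit 0 or b),
-- so appending the base-b digit 0 or 1 to N acts on the pair (#N, #(N − 1)) by
-- (x, y) ↦ (x + y, y) or (x, y) ↦ (x, x + y). Written in base b, G_k(m) − 1 is
-- 1 0^(k−m+1) (1 0)^t for m = 2t + 1, with one more 0 appended for m = 2t + 2.
-- Starting from (#1, #0) = (1, 1), these steps walk along the sequence
-- H′ z j = F (j + 2) + z F j with z = k − m, which satisfies the Fibonacci recurrence.

module Submission where

open import Defs
open import Data.Nat using (ℕ; zero; suc; pred; _+_; _*_; _∸_; _^_; _≤_; _<_; z≤n; s≤s; NonZero; >-nonZero⁻¹)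
open import Data.Nat.Properties
open import Data.Nat.DivMod using (_%_; _/_; [m+kn]%n≡m%n; m<n⇒m%n≡m; m/n≡1+[m∸n]/n)
open import Data.Nat.Tactic.RingSolver using (solve-∀)
open import Data.List using (List; []; _∷_; _++_; map; concatMap; filter; length; upTo)
open import Data.List.Properties using (filter-++; filter-≐; filter-none; filter-accept; filter-reject; length-++; concatMap-++; upTo-∷ʳ; ++-identityʳ)
open import Data.List.Relation.Unary.All using (universal)
open import Data.Maybe using (just)
open import Data.Product using (_,_; ∃-syntax)
open import Data.Sum using (_⊎_; inj₁; inj₂)
open import Data.Bool using (true; false)
open import Function using (_∘_)
open import Algebra.Properties.CommutativeSemigroup +-commutativeSemigroup using (interchange)
open import Relation.Nullary using (¬_; does; contradiction)
open import Level using (0ℓ)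
open import Relation.Unary using (Pred; Decidable; _≐_)
open import Relation.Binary.PropositionalEquality

sumTo-cong : ∀ n {f g : ℕ → ℕ} → (∀ i → f i ≡ g i) → sumTo n f ≡ sumTo n g
sumTo-cong zero    f≗g = refl
sumTo-cong (suc n) f≗g = cong₂ _+_ (sumTo-cong n f≗g) (f≗g n)

sumTo-zero : ∀ n {f : ℕ → ℕ} → (∀ i → i < n → f i ≡ 0) → sumTo n f ≡ 0
sumTo-zero zero    vanish = refl
sumTo-zero (suc n) vanish =
  cong₂ _+_ (sumTo-zero n (λ i i<n → vanish i (m<n⇒m<1+n i<n))) (vanish n ≤-refl)

sumTo-single : ∀ {n r} {f : ℕ → ℕ} → r < n → (∀ i → i < n → i ≢ r → f i ≡ 0) →
  sumTo n f ≡ f r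
sumTo-single {suc n} {r} {f} r<1+n vanish with m≤n⇒m<n∨m≡n (≤-pred r<1+n)
... | inj₁ r<n  = trans (cong₂ _+_ (sumTo-single r<n (λ i i<n → vanish i (m<n⇒m<1+n i<n)))
                                   (vanish n ≤-refl (≢-sym (<⇒≢ r<n))))
                        (+-identityʳ (f r))
... | inj₂ refl = cong (_+ f r) (sumTo-zero r (λ i i<r → vanish i (m<n⇒m<1+n i<r) (<⇒≢ i<r)))

sumTo-shift : ∀ n (f : ℕ → ℕ) → sumTo (suc n) f ≡ f 0 + sumTo n (f ∘ suc)
sumTo-shift zero    f = +-comm 0 (f 0)
sumTo-shift (suc n) f = trans (cong (_+ f (suc n)) (sumTo-shift n f)) (+-assoc (f 0) _ _)

count : {A : Set} {P : Pred A 0ℓ} → Decidable P → List A → ℕ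
count P? xs = length (filter P? xs)

module _ {A : Set} {P : Pred A 0ℓ} (P? : Decidable P) where

  count-++ : ∀ xs ys → count P? (xs ++ ys) ≡ count P? xs + count P? ys
  count-++ xs ys = trans (cong length (filter-++ P? xs ys)) (length-++ (filter P? xs))

  count-map : {B : Set} (f : B → A) (xs : List B) → count P? (map f xs) ≡ count (P? ∘ f) xs
  count-map f [] = refl
  count-map f (x ∷ xs) with does (P? (f x))
  ... | true  = cong suc (count-map f xs)
  ... | false = count-map f xs

  count-≐ : {Q : Pred A 0ℓ} (Q? : Decidable Q) → P ≐ Q → ∀ xs → count P? xs ≡ count Q? xs
  count-≐ Q? P≐Q xs = cong length (filter-≐ P? Q? P≐Q xs)

  count-none : (∀ x → ¬ P x) → ∀ xs → count P? xs ≡ 0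
  count-none ¬P xs = cong length (filter-none P? (universal ¬P xs))

  count-concatMap-upTo : (f : ℕ → List A) (n : ℕ) →
    count P? (concatMap f (upTo n)) ≡ sumTo n (count P? ∘ f)
  count-concatMap-upTo f zero = refl
  count-concatMap-upTo f (suc n) = begin
    count P? (concatMap f (upTo (suc n)))
      ≡⟨ cong (count P? ∘ concatMap f) (sym (upTo-∷ʳ n)) ⟩
    count P? (concatMap f (upTo n ++ n ∷ []))
      ≡⟨ cong (count P?) (concatMap-++ f (upTo n) (n ∷ [])) ⟩
    count P? (concatMap f (upTo n) ++ (f n ++ []))
      ≡⟨ count-++ (concatMap f (upTo n)) (f n ++ []) ⟩
    count P? (concatMap f (upTo n)) + count P? (f n ++ [])
      ≡⟨ cong₂ _+_ (count-concatMap-upTo f n) (cong (count P?) (++-identityʳ (f n))) ⟩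
    sumTo n (count P? ∘ f) + count P? (f n) ∎
    where open ≡-Reasoning

count-words-suc : ∀ b {P : Pred (List ℕ) 0ℓ} (P? : Decidable P) j →
  count P? (words b (suc j)) ≡ sumTo (suc b) (λ d → count (λ ws → P? (d ∷ ws)) (words b j))
count-words-suc b P? j = trans (count-concatMap-upTo P? (λ d → map (d ∷_) (words b j)) (suc b))
  (sumTo-cong (suc b) (λ d → count-map P? (d ∷_) (words b j)))

isZero : ℕ → ℕ
isZero zero    = 1
isZero (suc _) = 0

isZero-nonZero : ∀ N .{{_ : NonZero N}} → isZero N ≡ 0
isZero-nonZero (suc _) = refl

#exp : ℕ → ℕ → ℕ → ℕ
#exp b L N = count (isOverExp? b N) (words b L)

#expEndingIn : ℕ → ℕ → ℕ → ℕ → ℕ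
#expEndingIn b d j N = count (λ ws → isOverExp? b N (d ∷ ws)) (words b j)

-- The empty word is counted as an expansion of 0; this makes the digit recurrences uniform.
#exp≤ : ℕ → ℕ → ℕ → ℕ
#exp≤ b zero    N = isZero N
#exp≤ b (suc L) N = #exp≤ b L N + #exp b (suc L) N

module _ (b : ℕ) .{{_ : NonZero b}} where

  low-digit-unique : ∀ {d r x y} → d < b → r < b → d + b * x ≡ r + b * y → d ≡ r
  low-digit-unique {d} {r} {x} {y} d<b r<b eq = begin
    d                ≡⟨ m<n⇒m%n≡m d<b ⟨
    d % b            ≡⟨ mod-low d x ⟨
    (d + b * x) % b  ≡⟨ cong (_% b) eq ⟩
    (r + b * y) % b  ≡⟨ mod-low r y ⟩
    r % b            ≡⟨ m<n⇒m%n≡m r<b ⟩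
    r                ∎
    where
    open ≡-Reasoning
    mod-low : ∀ d x → (d + b * x) % b ≡ d % b
    mod-low d x = trans (cong (λ t → (d + t) % b) (*-comm b x)) ([m+kn]%n≡m%n d x b)

  nonzero-digit-unique : ∀ {d r x y} → 0 < r → r < b → d ≤ b → d + b * x ≡ r + b * y → d ≡ r
  nonzero-digit-unique {x = x} 0<r r<b d≤b eq with m≤n⇒m<n∨m≡n d≤b
  ... | inj₁ d<b  = low-digit-unique d<b r<b eq
  ... | inj₂ refl = contradiction (low-digit-unique (>-nonZero⁻¹ b) r<b (trans (*-suc b x) eq)) (<⇒≢ 0<r)

  low-digit-cancel : ∀ {d x y} → d + b * x ≡ d + b * y → x ≡ y
  low-digit-cancel {d} {x} {y} eq = *-cancelˡ-≡ x y b (+-cancelˡ-≡ d _ _ eq)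

  #expEndingIn-suc : ∀ d j M → #expEndingIn b d (suc j) (d + b * M) ≡ #exp b (suc j) M
  #expEndingIn-suc d j M = begin
    #expEndingIn b d (suc j) (d + b * M)
      ≡⟨ count-words-suc b (λ ws → isOverExp? b (d + b * M) (d ∷ ws)) j ⟩
    sumTo (suc b) (λ e → count (λ ws → isOverExp? b (d + b * M) (d ∷ e ∷ ws)) (words b j))
      ≡⟨ sumTo-cong (suc b) (λ e → count-≐ _ _ (drop-low-digit e) (words b j)) ⟩
    sumTo (suc b) (λ e → count (λ ws → isOverExp? b M (e ∷ ws)) (words b j))
      ≡⟨ count-words-suc b (isOverExp? b M) j ⟨
    #exp b (suc j) M ∎
    where
    open ≡-Reasoning
    drop-low-digit : ∀ e → (λ ws → IsOverExp b (d + b * M) (d ∷ e ∷ ws)) ≐ (λ ws → IsOverExp b M (e ∷ ws))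
    drop-low-digit e = (λ (lead , eq) → lead , low-digit-cancel eq)
                     , (λ (lead , eq) → lead , cong (λ x → d + b * x) eq)

  #expEndingIn-one : ∀ d M → 0 < d → #expEndingIn b d 0 (d + b * M) ≡ isZero M
  #expEndingIn-one (suc r) zero    _ = cong length
    (filter-accept (λ ws → isOverExp? b (suc r + b * 0) (suc r ∷ ws)) {[]} {[]}
                   (((λ ()) , (λ ())) , refl))
  #expEndingIn-one (suc r) (suc M) _ = cong length
    (filter-reject (λ ws → isOverExp? b (suc r + b * suc M) (suc r ∷ ws)) {[]} {[]}
                   (λ (_ , eq) → 0≢1+n (low-digit-cancel eq)))

  #expEndingIn-none : ∀ {d N} j → (∀ x → d + b * x ≢ N) → #expEndingIn b d j N ≡ 0
  #expEndingIn-none j ¬eq = count-none _ (λ ws (_ , eq) → ¬eq (value b ws) eq) (words b j)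

  value-nonzero : ∀ ds → LeadingNonzero ds → value b ds ≢ 0
  value-nonzero []           (_ , ≢nothing) _  = ≢nothing refl
  value-nonzero (d ∷ [])     (≢just0 , _)   eq = ≢just0 (cong just (m+n≡0⇒m≡0 d eq))
  value-nonzero (d ∷ e ∷ ds) lead           eq =
    value-nonzero (e ∷ ds) lead (*-cancelˡ-≡ _ 0 b (trans (m+n≡0⇒n≡0 d eq) (sym (*-zeroʳ b))))

  #exp-zero : ∀ L → #exp b L 0 ≡ 0
  #exp-zero L = count-none (isOverExp? b 0) (λ ds (lead , eq) → value-nonzero ds lead eq) (words b L)

  #exp≤-zero : ∀ L → #exp≤ b L 0 ≡ 1
  #exp≤-zero zero    = refl
  #exp≤-zero (suc L) = cong₂ _+_ (#exp≤-zero L) (#exp-zero (suc L))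

  #exp-nonzeroDigit : ∀ {r} → 0 < r → r < b → ∀ j M →
    #exp b (suc j) (r + b * M) ≡ #expEndingIn b r j (r + b * M)
  #exp-nonzeroDigit 0<r r<b j M =
    trans (count-words-suc b (isOverExp? b _) j)
      (sumTo-single (m<n⇒m<1+n r<b) (λ d d<1+b d≢r →
        #expEndingIn-none j (λ x eq → d≢r (nonzero-digit-unique 0<r r<b (≤-pred d<1+b) eq))))

  #exp≤-nonzeroDigit : ∀ {r} → 0 < r → r < b → ∀ L M → #exp≤ b (suc L) (r + b * M) ≡ #exp≤ b L M
  #exp≤-nonzeroDigit {suc r} 0<r r<b zero M =
    trans (#exp-nonzeroDigit 0<r r<b 0 M) (#expEndingIn-one (suc r) M 0<r)
  #exp≤-nonzeroDigit {r} 0<r r<b (suc L) M =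
    cong₂ _+_ (#exp≤-nonzeroDigit 0<r r<b L M)
              (trans (#exp-nonzeroDigit 0<r r<b (suc L) M) (#expEndingIn-suc r L M))

  #exp-zeroDigit : ∀ j M →
    #exp b (suc j) (b * suc M) ≡ #expEndingIn b 0 j (b * suc M) + #expEndingIn b b j (b + b * M)
  #exp-zeroDigit j M =
    trans (count-words-suc b (isOverExp? b _) j)
      (cong₂ _+_ (sumTo-single (>-nonZero⁻¹ b) (λ d d<b d≢0 →
                    #expEndingIn-none j (λ x eq → d≢0 (low-digit-unique d<b (>-nonZero⁻¹ b) eq))))
                 (cong (#expEndingIn b b j) (*-suc b M)))

  #exp≤-zeroDigit : ∀ L M → #exp≤ b (suc L) (b * suc M) ≡ #exp≤ b L (suc M) + #exp≤ b L M
  -- The one-digit word 0 is no over-expansion, so #expEndingIn b 0 0 _ computes to 0.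
  #exp≤-zeroDigit zero    M = cong₂ _+_ (isZero-nonZero (b * suc M) {{m*n≢0 b (suc M)}})
    (trans (#exp-zeroDigit 0 M) (#expEndingIn-one b M (>-nonZero⁻¹ b)))
  #exp≤-zeroDigit (suc L) M = begin
    #exp≤ b (suc L) (b * suc M) + #exp b (suc (suc L)) (b * suc M)
      ≡⟨ cong₂ _+_ (#exp≤-zeroDigit L M)
                   (trans (#exp-zeroDigit (suc L) M)
                          (cong₂ _+_ (#expEndingIn-suc 0 L (suc M)) (#expEndingIn-suc b L M))) ⟩
    (#exp≤ b L (suc M) + #exp≤ b L M) + (#exp b (suc L) (suc M) + #exp b (suc L) M)
      ≡⟨ interchange (#exp≤ b L (suc M)) _ _ _ ⟩
    (#exp≤ b L (suc M) + #exp b (suc L) (suc M)) + (#exp≤ b L M + #exp b (suc L) M) ∎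
    where open ≡-Reasoning

s-#exp≤ : ∀ b {N} → 0 < N → s b (suc N) ≡ #exp≤ b N N
s-#exp≤ b {suc n} _ =
  trans (count-concatMap-upTo (isOverExp? b (suc n)) (λ L → words b (suc L)) (suc n))
        (sym (#exp≤-sumTo (suc n)))
  where
  #exp≤-sumTo : ∀ L → #exp≤ b L (suc n) ≡ sumTo L (λ j → #exp b (suc j) (suc n))
  #exp≤-sumTo zero    = refl
  #exp≤-sumTo (suc L) = cong (_+ #exp b (suc L) (suc n)) (#exp≤-sumTo L)

hTail : ℕ → ℕ → ℕ
hTail b (suc (suc (suc m))) = b ^ suc m + hTail b (suc m)
hTail b _                   = 0

h≡1+hTail : ∀ b m → h b m ≡ suc (hTail b m)
h≡1+hTail b zero                = refl
h≡1+hTail b (suc zero)          = refl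
h≡1+hTail b (suc (suc zero))    = refl
h≡1+hTail b (suc (suc (suc m))) = cong suc (sumTo-hTail m)
  where
  open ≡-Reasoning
  ∸-two : ∀ n i → n ∸ 2 * suc i ≡ n ∸ 2 ∸ 2 * i
  ∸-two n i = trans (cong (n ∸_) (*-suc 2 i)) (sym (∸-+-assoc n 2 (2 * i)))
  sumTo-hTail : ∀ m → sumTo (suc (m / 2)) (λ i → b ^ ((m + 3) ∸ 2 ∸ 2 * i)) ≡ hTail b (3 + m)
  sumTo-hTail zero          = +-comm 0 (b ^ 1)
  sumTo-hTail (suc zero)    = +-comm 0 (b ^ 2)
  sumTo-hTail (suc (suc m)) = begin
    sumTo (suc (suc (suc m) / 2)) f
      ≡⟨ cong (λ q → sumTo (suc q) f) (m/n≡1+[m∸n]/n {suc (suc m)} {2} (s≤s (s≤s z≤n))) ⟩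
    sumTo (suc (suc (m / 2))) f
      ≡⟨ sumTo-shift (suc (m / 2)) f ⟩
    f 0 + sumTo (suc (m / 2)) (f ∘ suc)
      ≡⟨ cong₂ _+_ (cong (b ^_) (+-comm m 3))
                   (sumTo-cong (suc (m / 2)) (λ i → cong (b ^_) (∸-two (m + 3) i))) ⟩
    b ^ (3 + m) + sumTo (suc (m / 2)) (λ i → b ^ ((m + 3) ∸ 2 ∸ 2 * i))
      ≡⟨ cong (b ^ (3 + m) +_) (sumTo-hTail m) ⟩
    hTail b (5 + m) ∎
    where
    f : ℕ → ℕ
    f i = b ^ ((suc (suc m) + 3) ∸ 2 ∸ 2 * i)

hTail-odd : ∀ b t → hTail b (3 + t * 2) ≡ b + b * b * hTail b (1 + t * 2)
hTail-odd b zero    = cong₂ _+_ (*-identityʳ b) (sym (*-zeroʳ (b * b)))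
hTail-odd b (suc t) = trans (cong (b ^ (3 + t * 2) +_) (hTail-odd b t))
                           (regroup b (b ^ (1 + t * 2)) (hTail b (1 + t * 2)))
  where
  regroup : ∀ b P A → b * (b * P) + (b + b * b * A) ≡ b + b * b * (P + A)
  regroup = solve-∀

hTail-even : ∀ b t → hTail b (2 + t * 2) ≡ b * hTail b (1 + t * 2)
hTail-even b zero    = sym (*-zeroʳ b)
hTail-even b (suc t) = trans (cong (b ^ (2 + t * 2) +_) (hTail-even b t))
                            (sym (*-distribˡ-+ b (b ^ (1 + t * 2)) (hTail b (1 + t * 2))))

odd-or-even : ∀ n → ∃[ t ] (n ≡ t * 2 ⊎ n ≡ suc (t * 2))
odd-or-even zero    = 0 , inj₁ refl
odd-or-even (suc n) with odd-or-even n
... | t , inj₁ refl = t , inj₂ refl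
... | t , inj₂ refl = suc t , inj₁ refl

H′ : ℕ → ℕ → ℕ
H′ z m = F (m + 2) + z * F m

H′-rec : ∀ z j → H′ z (suc (suc j)) ≡ H′ z (suc j) + H′ z j
H′-rec z j = trans (cong (F (suc (j + 2)) + F (j + 2) +_) (*-distribˡ-+ z (F (suc j)) (F j)))
                   (interchange (F (suc (j + 2))) (F (j + 2)) (z * F (suc j)) (z * F j))

module _ (c : ℕ) where

  private
    b : ℕ
    b = suc (suc c)

  n<b^n : ∀ n → n < b ^ n
  n<b^n zero    = s≤s z≤n
  n<b^n (suc n) = ≤-trans (s≤s (n<b^n n)) (^-monoʳ-< b (s≤s (s≤s z≤n)) (n<1+n n))

  0<b^k+ : ∀ k x → 0 < b ^ k + x
  0<b^k+ k x = ≤-trans (m^n>0 b k) (m≤m+n (b ^ k) x)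

  record Counts (L N x y : ℕ) : Set where
    constructor _,_
    field
      at-N      : #exp≤ b L N ≡ x
      at-pred-N : #exp≤ b L (pred N) ≡ y

  Counts-resp : ∀ {L N N′ x x′ y y′} → N ≡ N′ → x ≡ x′ → y ≡ y′ →
                Counts L N x y → Counts L N′ x′ y′
  Counts-resp refl refl refl counts = counts

  append0 : ∀ {L N x y} → 0 < N → Counts L N x y → Counts (suc L) (b * N) (x + y) y
  append0 {L} {suc n} _ (x≡ , y≡) =
    trans (#exp≤-zeroDigit b L n) (cong₂ _+_ x≡ y≡) ,
    trans (cong (#exp≤ b (suc L) ∘ pred) (*-suc b n))
          (trans (#exp≤-nonzeroDigit b (s≤s z≤n) ≤-refl L n) y≡)

  append1 : ∀ {L N x y} → 0 < N → Counts L N x y → Counts (suc L) (suc (b * N)) x (x + y)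
  append1 {L} {suc n} _ (x≡ , y≡) =
    trans (#exp≤-nonzeroDigit b {1} (s≤s z≤n) (s≤s (s≤s z≤n)) L (suc n)) x≡ ,
    trans (#exp≤-zeroDigit b L n) (cong₂ _+_ x≡ y≡)

  counts-power : ∀ j L → Counts (j + suc L) (b ^ j) (suc j) 1
  counts-power zero    L =
    trans (cong (#exp≤ b (suc L) ∘ suc) (sym (*-zeroʳ b)))
          (trans (#exp≤-nonzeroDigit b {1} (s≤s z≤n) (s≤s (s≤s z≤n)) L 0) (#exp≤-zero b L)) ,
    #exp≤-zero b (suc L)
  counts-power (suc j) L =
    Counts-resp refl (+-comm (suc j) 1) refl (append0 (m^n>0 b j) (counts-power j L))

  counts-odd : ∀ t z L → Counts (suc (t * 2) + z + suc L) (b ^ (suc (t * 2) + z) + hTail b (suc (t * 2)))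
                                 (H′ z (suc (t * 2))) (H′ z (t * 2))
  counts-odd zero    z L = Counts-resp (sym (+-identityʳ _)) (cong (2 +_) (sym (*-identityʳ z)))
                             (cong suc (sym (*-zeroʳ z))) (counts-power (suc z) L)
  counts-odd (suc t) z L =
    Counts-resp N≡ x≡ y≡ (append0 (s≤s z≤n) (append1 (0<b^k+ k _) (counts-odd t z L)))
    where
    k = suc (t * 2) + z
    m = suc (t * 2)
    N≡ : b * suc (b * (b ^ k + hTail b m)) ≡ b ^ (2 + k) + hTail b (2 + m)
    N≡ = trans (regroup b (b ^ k) (hTail b m)) (cong (b ^ (2 + k) +_) (sym (hTail-odd b t)))
      where
      regroup : ∀ b P A → b * suc (b * (P + A)) ≡ b * (b * P) + (b + b * b * A)
      regroup = solve-∀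
    y≡ : H′ z m + H′ z (t * 2) ≡ H′ z (suc m)
    y≡ = sym (H′-rec z (t * 2))
    x≡ : H′ z m + (H′ z m + H′ z (t * 2)) ≡ H′ z (2 + m)
    x≡ = trans (+-comm (H′ z m) _) (trans (cong (_+ H′ z m) y≡) (sym (H′-rec z m)))

  #exp≤-G : ∀ m z L → 0 < m → #exp≤ b (m + z + suc L) (b ^ (m + z) + hTail b m) ≡ H′ z m
  #exp≤-G (suc n) z L _ with odd-or-even n
  ... | t , inj₁ refl = Counts.at-N (counts-odd t z L)
  ... | t , inj₂ refl = Counts.at-N (Counts-resp N≡ (sym (H′-rec z (t * 2))) refl
                                       (append0 (0<b^k+ k _) (counts-odd t z L)))
    where
    k = suc (t * 2) + z
    N≡ : b * (b ^ k + hTail b (suc (t * 2))) ≡ b ^ suc k + hTail b (2 + t * 2)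
    N≡ = trans (*-distribˡ-+ b (b ^ k) _) (cong (b ^ suc k +_) (sym (hTail-even b t)))

  s-G : ∀ m z → 0 < m → s b (G b (m + z) m) ≡ H (m + z) m
  s-G m z 0<m = begin
    s b (G b k m)           ≡⟨ cong (s b) (trans (cong (b ^ k +_) (h≡1+hTail b m)) (+-suc (b ^ k) _)) ⟩
    s b (suc N)             ≡⟨ s-#exp≤ b (0<b^k+ k _) ⟩
    #exp≤ b N N             ≡⟨ cong (λ L → #exp≤ b L N) slack ⟨
    #exp≤ b (k + suc L₀) N  ≡⟨ #exp≤-G m z L₀ 0<m ⟩
    H′ z m                  ≡⟨ cong (λ z → F (m + 2) + z * F m) (m+n∸m≡n m z) ⟨
    H k m                   ∎
    where
    open ≡-Reasoning
    k  = m + z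
    N  = b ^ k + hTail b m
    -- s bounds the length by N, which exceeds the k + 1 digits of N by L₀.
    L₀ = N ∸ suc k
    slack : k + suc L₀ ≡ N
    slack = trans (+-suc k L₀) (m+[n∸m]≡n (≤-trans (n<b^n k) (m≤m+n (b ^ k) _)))

theorem25 : (b : ℕ) → 2 ≤ b → (k m : ℕ) → 2 ≤ m → m ≤ k →
    s b (G b k m) ≡ H k m
theorem25 b@(suc (suc c)) (s≤s (s≤s z≤n)) k m 2≤m m≤k =
  subst (λ k → s b (G b k m) ≡ H k m) (m+[n∸m]≡n m≤k) (s-G c m (k ∸ m) (≤-trans (s≤s z≤n) 2≤m))
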